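{- Let $G$ be a graph, $S\subseteq V(G)$, $f:S\to\mathbb{N}$ with $f(s)\geq 1$ for all $s\in S$, $d:=\sum_{s\in S}f(s)$, and $M=M(S,f)$. Let $\mathfrak{R}_1=\{f(S'): S'\subseteq S,\ |S'|\geq 1\}$ and $\mathfrak{R}_2=\{f(S'): S'\subseteq S,\ |S'|\geq 2\}$, where $f(S')=\sum_{s\in S'}f(s)$. Then: (1) if $k\in\{1,\dots,d\}\setminus\mathfrak{R}_1$, then $\mathcal{E}(G;M,q)[q^k]=0$; (2) if $k\in\mathfrak{R}_1\setminus\mathfrak{R}_2$, then $\mathcal{E}(G;M,q)[q^k]\leq 0$; (3) $\mathcal{E}(G;M,q)[q^0]=|\mathrm{Obs}(G;S)|\geq 0$.
   Context: Graphs are finite and simple; $N[X]$ is the closed neighborhood of $X$. Power domination process on a graph $H$ from $T\subseteq V(H)$: set $B:=N[T]$; then, while some $x\in B$ has exactly one vertex $y$ of $N[x]$ outside $B$, add $y$ to $B$. The final set is $\mathrm{Obs}(H;T)$ (with $\mathrm{Obs}(H;\emptyset)=\emptyset$). For a multiset placement $M=M(S,f)$ (support $S$, multiplicity $f(s)$ at $s$, each sensor failing independently with probability $q$), $\mathcal{E}(H;M,q)=\sum_{S'\subseteq S}|\mathrm{Obs}(H;S')|\,q^{f(S\setminus S')}\prod_{s\in S'}(1-q^{f(s)})$. For a polynomial $p$ in $q$, $p[q^j]$ is the coefficient of $q^j$. -}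

module Defs where

open import Data.Bool using (Bool; true; false; _∧_; _∨_; not; if_then_else_)
open import Data.Nat using (ℕ; zero; suc; _+_; _≤_)
open import Data.Fin using (Fin)
open import Data.Fin.Subset using (Subset; _⊆_; ∣_∣; ⁅_⁆)
open import Data.Fin.Subset.Properties using (_⊆?_)
open import Data.Vec using (Vec; []; _∷_; lookup; updateAt; tabulate)
open import Data.List using (List; []; _∷_; map; filter; concatMap; length; foldr; allFin)
open import Data.Maybe using (Maybe; just; nothing)
open import Data.Integer using (ℤ; +_; -_) renaming (_+_ to _+ℤ_; _*_ to _*ℤ_)
open import Relation.Binary.PropositionalEquality using (_≡_)
import Data.Fin
import Data.Vec
import Data.Product
import Relation.Nullary
import Relation.Nullary.Decidable.Core

record Graph (n : ℕ) : Set where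
  field
    adj    : Fin n → Fin n → Bool
    sym    : ∀ u v → adj u v ≡ adj v u
    irrefl : ∀ v → adj v v ≡ false
open Graph public

mem : ∀ {n} → Fin n → Subset n → Bool
mem i X = lookup X i

inClosedNbhd : ∀ {n} → Graph n → Fin n → Fin n → Bool
inClosedNbhd {n} G x y with Data.Fin._≟_ x y
... | Relation.Nullary.yes _ = true
... | Relation.Nullary.no  _ = adj G x y

closedNbhd : ∀ {n} → Graph n → Subset n → Subset n
closedNbhd {n} G T =
  tabulate (λ y → foldr (λ x b → (mem x T ∧ inClosedNbhd G x y) ∨ b) false (allFin n))

outsideNbrs : ∀ {n} → Graph n → Subset n → Fin n → List (Fin n)
outsideNbrs {n} G B x = filter (λ y → Relation.Nullary.Decidable.Core.T? (inClosedNbhd G x y ∧ not (mem y B))) (allFin n)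

forcedFrom : ∀ {n} → Graph n → Subset n → List (Fin n) → Maybe (Fin n)
forcedFrom G B [] = nothing
forcedFrom G B (x ∷ xs) with mem x B | outsideNbrs G B x
... | true | y ∷ [] = just y
... | _    | _      = forcedFrom G B xs

-- run the forcing process with fuel (each step adds a new vertex, so n steps suffice)
propagate : ∀ {n} → Graph n → ℕ → Subset n → Subset n
propagate G zero B = B
propagate {n} G (suc k) B with forcedFrom G B (allFin n)
... | nothing = B
... | just y  = propagate G k (updateAt B y (λ _ → true))

Obs : ∀ {n} → Graph n → Subset n → Subset n
Obs {n} G T = propagate G n (closedNbhd G T)

allSubsets : ∀ n → List (Subset n)
allSubsets zero = [] ∷ []
allSubsets (suc n) = concatMap (λ X → (true ∷ X) ∷ (false ∷ X) ∷ []) (allSubsets n)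

subsetsOf : ∀ {n} → Subset n → List (Subset n)
subsetsOf {n} S = filter (λ S' → S' ⊆? S) (allSubsets n)

fsum : ∀ {n} → (Fin n → ℕ) → Subset n → ℕ
fsum {n} f X = foldr (λ i acc → (if mem i X then f i else 0) + acc) 0 (allFin n)

-- Polynomials in q with integer coefficients, as coefficient lists
-- (index j = coefficient of q^j)

Poly : Set
Poly = List ℤ

coeff : Poly → ℕ → ℤ
coeff [] _ = + 0
coeff (a ∷ _) zero = a
coeff (_ ∷ p) (suc j) = coeff p j

_+P_ : Poly → Poly → Poly
[] +P q = q
(a ∷ p) +P [] = a ∷ p
(a ∷ p) +P (b ∷ q) = (a +ℤ b) ∷ (p +P q)

scaleP : ℤ → Poly → Poly
scaleP c = map (c *ℤ_)

_*P_ : Poly → Poly → Poly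
[] *P q = []
(a ∷ p) *P q = scaleP a q +P (+ 0 ∷ (p *P q))

constP : ℤ → Poly
constP c = c ∷ []

monoP : ℕ → Poly
monoP zero = constP (+ 1)
monoP (suc k) = + 0 ∷ monoP k

oneMinus : ℕ → Poly
oneMinus k = constP (+ 1) +P scaleP (- (+ 1)) (monoP k)

prodP : List Poly → Poly
prodP = foldr _*P_ (constP (+ 1))

sumP : List Poly → Poly
sumP = foldr _+P_ []

members : ∀ {n} → Subset n → List (Fin n)
members {n} X = filter (λ i → Relation.Nullary.Decidable.Core.T? (mem i X)) (allFin n)

diff : ∀ {n} → Subset n → Subset n → Subset n
diff S S' = Data.Vec.zipWith (λ a b → a ∧ not b) S S'

expObs : ∀ {n} → Graph n → Subset n → (Fin n → ℕ) → Poly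
expObs G S f = sumP (map term (subsetsOf S))
  where
  term : _ → Poly
  term S' = scaleP (+ ∣ Obs G S' ∣)
              (monoP (fsum f (diff S S')) *P prodP (map (λ s → oneMinus (f s)) (members S')))

InR : ∀ {n} → ℕ → Subset n → (Fin n → ℕ) → ℕ → Set
InR {n} m S f k = Data.Product.Σ (Subset n) (λ S' → S' ⊆ S Data.Product.× (m ≤ ∣ S' ∣ Data.Product.× fsum f S' ≡ k))

{-# OPTIONS --safe #-}

-- Write 𝓔_S(w) = Σ_{X ⊆ S} w(X) q^{f(S∖X)} Π_{s∈X} (1 − q^{f s}) for an arbitrary weight w on the
-- subsets of S; the polynomial 𝓔(G;M,q) is the case w(X) = |Obs(G;X)|. Splitting the sum according
-- to whether the first sensor s₀, with a = f(s₀), lies in X gives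
--   𝓔_S(w) = (1 − q^a) 𝓔_{S'}(w(· ∪ {s₀})) + q^a 𝓔_{S'}(w),   S' = S ∖ {s₀},
-- and all three parts follow by induction along this recursion. As a ≥ 1 the constant term is that
-- of the first summand, i.e. w(S). If k ≥ 1 is no nonempty subset sum of S, then k is none of S'
-- and k − a is no subset sum of S' at all (not even the empty one), so every contribution to [q^k]
-- vanishes. If k is a subset sum but no sum of two or more values, the shifted terms contribute
-- only at k = a, where they give w(S') − w(S' ∪ {s₀}) ≤ 0 for monotone w. Finally X ↦ |Obs(G;X)| is
-- monotone because Obs(G;X) is the least set containing N[X] that is closed under forcing: a forced
-- vertex lies in every closed superset of the current set, and the process ends in a closed set,
-- as it either gets stuck or adds a new vertex in each of its n steps and so reaches V(G).

module Submission where

open import Defs hiding (sym)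
open import Data.Nat using (ℕ; _≤_)
open import Data.Fin using (Fin)
open import Data.Fin.Subset using (Subset; _∈_; ∣_∣)
open import Data.Integer using (ℤ; +_) renaming (_≤_ to _≤ℤ_)
open import Data.Product using (_×_)
open import Relation.Nullary using (¬_)
open import Relation.Binary.PropositionalEquality using (_≡_)

open import Data.Bool using (Bool; true; false; _∧_; _∨_; not; T; if_then_else_)
import Data.Bool.Properties as Bool
open import Data.Nat as ℕ using (zero; suc; z≤n; s≤s)
import Data.Nat.Properties as ℕ
open import Data.Fin using (zero; suc; _≟_)
open import Data.Fin.Subset using (_∉_; _⊆_; _⊂_; ⊥; ⊤)
open import Data.Fin.Subset.Properties
  using (_⊆?_; _∈?_; s⊆s; out⊆; ⊥⊆; ∈⊤; p⊂q⇒∣p∣<∣q∣; p⊆q⇒∣p∣≤∣q∣; ∣p∣≤n; ∣p∣≡n⇒p≡⊤)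
open import Data.Integer as ℤ using (-_; _-_; _+_; _*_; +≤+)
import Data.Integer.Properties as ℤ
open import Data.Integer.Tactic.RingSolver using (solve-∀)
open import Data.List using (List; []; _∷_; _++_; map; filter; concatMap; foldr; allFin; tabulate)
import Data.List.Properties as Listₚ
open import Data.List.Membership.Propositional using () renaming (_∈_ to _∈ˡ_)
open import Data.List.Membership.Propositional.Properties using (∈-filter⁻; ∈-allFin)
open import Data.List.Relation.Unary.Any using (here; there)
open import Data.Vec using ([]; _∷_; here; there; updateAt)
open import Data.Vec.Properties
  using ([]=⇒lookup; lookup⇒[]=; updateAt-updates; updateAt-minimal; lookup∘updateAt′; lookup∘tabulate)
open import Data.Maybe using (just; nothing)
open import Data.Maybe.Properties using (just-injective)
open import Data.Product using (∃-syntax; _,_; proj₂)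
open import Data.Sum using (_⊎_; inj₁; inj₂)
open import Data.Empty using (⊥-elim)
open import Function using (_∘_; id; case_of_; Equivalence)
open import Relation.Nullary using (yes; no; does; contradiction)
open import Relation.Nullary.Decidable.Core using (T?)
open import Relation.Unary using (Decidable)
open import Relation.Binary.PropositionalEquality
  using (refl; sym; trans; cong; cong₂; subst; subst₂; _≗_; module ≡-Reasoning)

-- Power series in q as coefficient sequences: shift a φ is q^a φ and oneMinusShift a φ is (1 − q^a) φ.
Seq : Set
Seq = ℕ → ℤ

shift : ℕ → Seq → Seq
shift zero    φ k       = φ k
shift (suc a) φ zero    = + 0
shift (suc a) φ (suc k) = shift a φ k

oneMinusShift : ℕ → Seq → Seq
oneMinusShift a φ k = φ k - shift a φ k

shift-cong : ∀ a {φ ψ : Seq} → φ ≗ ψ → shift a φ ≗ shift a ψ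
shift-cong zero    φ≗ψ k       = φ≗ψ k
shift-cong (suc a) φ≗ψ zero    = refl
shift-cong (suc a) φ≗ψ (suc k) = shift-cong a φ≗ψ k

shift-+ : ∀ a b (φ : Seq) → shift (a ℕ.+ b) φ ≗ shift a (shift b φ)
shift-+ zero    b φ k       = refl
shift-+ (suc a) b φ zero    = refl
shift-+ (suc a) b φ (suc k) = shift-+ a b φ k

shift-comm : ∀ a b (φ : Seq) → shift a (shift b φ) ≗ shift b (shift a φ)
shift-comm a b φ k = begin
  shift a (shift b φ) k  ≡⟨ shift-+ a b φ k ⟨
  shift (a ℕ.+ b) φ k    ≡⟨ cong (λ c → shift c φ k) (ℕ.+-comm a b) ⟩
  shift (b ℕ.+ a) φ k    ≡⟨ shift-+ b a φ k ⟩
  shift b (shift a φ) k  ∎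
  where open ≡-Reasoning

shift-zipWith : ∀ (g : ℤ → ℤ → ℤ) → g (+ 0) (+ 0) ≡ + 0 → ∀ a (φ ψ : Seq) →
  shift a (λ j → g (φ j) (ψ j)) ≗ λ k → g (shift a φ k) (shift a ψ k)
shift-zipWith g g00 zero    φ ψ k       = refl
shift-zipWith g g00 (suc a) φ ψ zero    = sym g00
shift-zipWith g g00 (suc a) φ ψ (suc k) = shift-zipWith g g00 a φ ψ k

shift-vanishes : ∀ a (φ : Seq) k → (∀ j → k ≡ a ℕ.+ j → φ j ≡ + 0) → shift a φ k ≡ + 0
shift-vanishes zero    φ k       φ≡0 = φ≡0 k refl
shift-vanishes (suc a) φ zero    φ≡0 = refl
shift-vanishes (suc a) φ (suc k) φ≡0 = shift-vanishes a φ k (λ j → φ≡0 j ∘ cong suc)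

oneMinusShift-cong : ∀ a {φ ψ : Seq} → φ ≗ ψ → oneMinusShift a φ ≗ oneMinusShift a ψ
oneMinusShift-cong a φ≗ψ k = cong₂ _-_ (φ≗ψ k) (shift-cong a φ≗ψ k)

shift-at-0 : ∀ {a} (φ : Seq) → 1 ≤ a → shift a φ 0 ≡ + 0
shift-at-0 {suc a} φ _ = refl

shift-mono-≤ : ∀ a (φ ψ : Seq) k → (∀ j → k ≡ a ℕ.+ j → φ j ≤ℤ ψ j) → shift a φ k ≤ℤ shift a ψ k
shift-mono-≤ zero    φ ψ k       φ≤ψ = φ≤ψ k refl
shift-mono-≤ (suc a) φ ψ zero    φ≤ψ = ℤ.≤-refl
shift-mono-≤ (suc a) φ ψ (suc k) φ≤ψ = shift-mono-≤ a φ ψ k (λ j → φ≤ψ j ∘ cong suc)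

shift-oneMinusShift : ∀ a b (φ : Seq) →
  shift a (oneMinusShift b φ) ≗ oneMinusShift b (shift a φ)
shift-oneMinusShift a b φ k =
  trans (shift-zipWith _-_ refl a φ (shift b φ) k) (cong (λ x → shift a φ k - x) (shift-comm a b φ k))

coeff-+P : ∀ p q k → coeff (p +P q) k ≡ coeff p k + coeff q k
coeff-+P []      q       k       = sym (ℤ.+-identityˡ _)
coeff-+P (a ∷ p) []      k       = sym (ℤ.+-identityʳ _)
coeff-+P (a ∷ p) (b ∷ q) zero    = refl
coeff-+P (a ∷ p) (b ∷ q) (suc k) = coeff-+P p q k

coeff-scaleP : ∀ c p k → coeff (scaleP c p) k ≡ c * coeff p k
coeff-scaleP c []      k       = sym (ℤ.*-zeroʳ c)
coeff-scaleP c (a ∷ p) zero    = refl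
coeff-scaleP c (a ∷ p) (suc k) = coeff-scaleP c p k

coeff-0∷ : ∀ p → coeff (+ 0 ∷ p) ≗ shift 1 (coeff p)
coeff-0∷ p zero    = refl
coeff-0∷ p (suc k) = refl

coeff-∷*P : ∀ a p q k → coeff ((a ∷ p) *P q) k ≡ a * coeff q k + shift 1 (coeff (p *P q)) k
coeff-∷*P a p q k =
  trans (coeff-+P (scaleP a q) _ k) (cong₂ _+_ (coeff-scaleP a q k) (coeff-0∷ (p *P q) k))

coeff-monoP-*P : ∀ m p → coeff (monoP m *P p) ≗ shift m (coeff p)
coeff-monoP-*P zero p k = begin
  coeff (monoP zero *P p) k
    ≡⟨ coeff-∷*P (+ 1) [] p k ⟩
  + 1 * coeff p k + shift 1 (λ _ → + 0) k
    ≡⟨ cong₂ _+_ (ℤ.*-identityˡ (coeff p k)) (shift-vanishes 1 _ k (λ _ _ → refl)) ⟩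
  coeff p k + + 0
    ≡⟨ ℤ.+-identityʳ _ ⟩
  coeff p k
    ∎
  where open ≡-Reasoning
coeff-monoP-*P (suc m) p k = begin
  coeff (monoP (suc m) *P p) k                     ≡⟨ coeff-∷*P (+ 0) (monoP m) p k ⟩
  + 0 + shift 1 (coeff (monoP m *P p)) k           ≡⟨ ℤ.+-identityˡ _ ⟩
  shift 1 (coeff (monoP m *P p)) k                 ≡⟨ shift-cong 1 (coeff-monoP-*P m p) k ⟩
  shift 1 (shift m (coeff p)) k                    ≡⟨ shift-+ 1 m (coeff p) k ⟨
  shift (suc m) (coeff p) k                        ∎
  where open ≡-Reasoning

coeff-+P-*P : ∀ p p' q k → coeff ((p +P p') *P q) k ≡ coeff (p *P q) k + coeff (p' *P q) k
coeff-+P-*P []      p'       q k = sym (ℤ.+-identityˡ _)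
coeff-+P-*P (a ∷ p) []       q k = sym (ℤ.+-identityʳ _)
coeff-+P-*P (a ∷ p) (b ∷ p') q k = begin
  coeff (((a + b) ∷ (p +P p')) *P q) k
    ≡⟨ coeff-∷*P (a + b) (p +P p') q k ⟩
  (a + b) * coeff q k + shift 1 (coeff ((p +P p') *P q)) k
    ≡⟨ cong (λ x → (a + b) * coeff q k + x) (shift-cong 1 (coeff-+P-*P p p' q) k) ⟩
  (a + b) * coeff q k + shift 1 (λ j → coeff (p *P q) j + coeff (p' *P q) j) k
    ≡⟨ cong (λ x → (a + b) * coeff q k + x)
            (shift-zipWith _+_ refl 1 (coeff (p *P q)) (coeff (p' *P q)) k) ⟩
  (a + b) * coeff q k + (shift 1 (coeff (p *P q)) k + shift 1 (coeff (p' *P q)) k)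
    ≡⟨ distrib-interchange a b (coeff q k) _ _ ⟩
  (a * coeff q k + shift 1 (coeff (p *P q)) k) + (b * coeff q k + shift 1 (coeff (p' *P q)) k)
    ≡⟨ cong₂ _+_ (coeff-∷*P a p q k) (coeff-∷*P b p' q k) ⟨
  coeff ((a ∷ p) *P q) k + coeff ((b ∷ p') *P q) k
    ∎
  where
  open ≡-Reasoning
  distrib-interchange : ∀ a b c u v → (a + b) * c + (u + v) ≡ (a * c + u) + (b * c + v)
  distrib-interchange = solve-∀

coeff-scaleP-*P : ∀ c p q k → coeff (scaleP c p *P q) k ≡ c * coeff (p *P q) k
coeff-scaleP-*P c []      q k = sym (ℤ.*-zeroʳ c)
coeff-scaleP-*P c (a ∷ p) q k = begin
  coeff (((c * a) ∷ scaleP c p) *P q) k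
    ≡⟨ coeff-∷*P (c * a) (scaleP c p) q k ⟩
  c * a * coeff q k + shift 1 (coeff (scaleP c p *P q)) k
    ≡⟨ cong (λ x → c * a * coeff q k + x) (shift-cong 1 (coeff-scaleP-*P c p q) k) ⟩
  c * a * coeff q k + shift 1 (λ j → c * coeff (p *P q) j) k
    ≡⟨ cong (λ x → c * a * coeff q k + x) (shift-zipWith (λ x _ → c * x) (ℤ.*-zeroʳ c) 1 φ φ k) ⟩
  c * a * coeff q k + c * shift 1 φ k
    ≡⟨ factor c a (coeff q k) (shift 1 φ k) ⟩
  c * (a * coeff q k + shift 1 φ k)
    ≡⟨ cong (c *_) (coeff-∷*P a p q k) ⟨
  c * coeff ((a ∷ p) *P q) k
    ∎
  where
  open ≡-Reasoning
  φ : Seq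
  φ = coeff (p *P q)
  factor : ∀ c a x y → c * a * x + c * y ≡ c * (a * x + y)
  factor = solve-∀

coeff-oneMinus-*P : ∀ a p → coeff (oneMinus a *P p) ≗ oneMinusShift a (coeff p)
coeff-oneMinus-*P a p k = begin
  coeff ((monoP 0 +P scaleP (- + 1) (monoP a)) *P p) k
    ≡⟨ coeff-+P-*P (monoP 0) (scaleP (- + 1) (monoP a)) p k ⟩
  coeff (monoP 0 *P p) k + coeff (scaleP (- + 1) (monoP a) *P p) k
    ≡⟨ cong₂ _+_ (coeff-monoP-*P 0 p k) (coeff-scaleP-*P (- + 1) (monoP a) p k) ⟩
  coeff p k + - + 1 * coeff (monoP a *P p) k
    ≡⟨ cong (λ x → coeff p k + x) (ℤ.-1*i≡-i _) ⟩
  coeff p k - coeff (monoP a *P p) k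
    ≡⟨ cong (λ x → coeff p k - x) (coeff-monoP-*P a p k) ⟩
  coeff p k - shift a (coeff p) k
    ∎
  where open ≡-Reasoning

∑ : {A : Set} → List A → (A → ℤ) → ℤ
∑ []       g = + 0
∑ (x ∷ xs) g = g x + ∑ xs g

syntax ∑ L (λ x → e) = ∑[ x ∈ L ] e

module _ {A : Set} where

  ∑-cong : ∀ (L : List A) {g h : A → ℤ} → (∀ x → g x ≡ h x) → ∑ L g ≡ ∑ L h
  ∑-cong []      g≗h = refl
  ∑-cong (x ∷ L) g≗h = cong₂ _+_ (g≗h x) (∑-cong L g≗h)

  ∑-++ : ∀ (L L' : List A) g → ∑ (L ++ L') g ≡ ∑ L g + ∑ L' g
  ∑-++ []      L' g = sym (ℤ.+-identityˡ _)
  ∑-++ (x ∷ L) L' g = trans (cong (λ y → g x + y) (∑-++ L L' g)) (sym (ℤ.+-assoc (g x) _ _))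

  ∑-+ : ∀ (L : List A) g h → ∑[ x ∈ L ] (g x + h x) ≡ ∑ L g + ∑ L h
  ∑-+ []      g h = refl
  ∑-+ (x ∷ L) g h = trans (cong (λ y → g x + h x + y) (∑-+ L g h)) (interchange (g x) (h x) _ _)
    where
    interchange : ∀ a b c d → (a + b) + (c + d) ≡ (a + c) + (b + d)
    interchange = solve-∀

  ∑-- : ∀ (L : List A) g h → ∑[ x ∈ L ] (g x - h x) ≡ ∑ L g - ∑ L h
  ∑-- []      g h = refl
  ∑-- (x ∷ L) g h = trans (cong (λ y → g x - h x + y) (∑-- L g h)) (interchange (g x) (h x) _ _)
    where
    interchange : ∀ a b c d → (a - b) + (c - d) ≡ (a + c) - (b + d)
    interchange = solve-∀

  ∑-filter : ∀ {P : A → Set} (P? : Decidable P) L g →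
    ∑ (filter P? L) g ≡ ∑[ x ∈ L ] (if does (P? x) then g x else + 0)
  ∑-filter P? []      g = refl
  ∑-filter P? (x ∷ L) g with does (P? x)
  ... | true  = cong (λ y → g x + y) (∑-filter P? L g)
  ... | false = trans (∑-filter P? L g) (sym (ℤ.+-identityˡ _))

  ∑-shift : ∀ (L : List A) (c : A → ℤ) (φ : A → Seq) a k →
    ∑[ x ∈ L ] (c x * shift a (φ x) k) ≡ shift a (λ j → ∑[ x ∈ L ] (c x * φ x j)) k
  ∑-shift []      c φ a k = sym (shift-vanishes a _ k (λ _ _ → refl))
  ∑-shift (x ∷ L) c φ a k =
    trans (cong (λ y → c x * shift a (φ x) k + y) (∑-shift L c φ a k))
          (sym (shift-zipWith (λ u v → c x * u + v) (trans (ℤ.+-identityʳ _) (ℤ.*-zeroʳ (c x)))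
                              a (φ x) _ k))

  ∑-oneMinusShift : ∀ (L : List A) (c : A → ℤ) (φ : A → Seq) a k →
    ∑[ x ∈ L ] (c x * oneMinusShift a (φ x) k) ≡ oneMinusShift a (λ j → ∑[ x ∈ L ] (c x * φ x j)) k
  ∑-oneMinusShift L c φ a k = begin
    ∑[ x ∈ L ] (c x * (φ x k - shift a (φ x) k))
      ≡⟨ ∑-cong L (λ x → distribˡ-- (c x) (φ x k) (shift a (φ x) k)) ⟩
    ∑[ x ∈ L ] (c x * φ x k - c x * shift a (φ x) k)
      ≡⟨ ∑-- L (λ x → c x * φ x k) (λ x → c x * shift a (φ x) k) ⟩
    ∑[ x ∈ L ] (c x * φ x k) - ∑[ x ∈ L ] (c x * shift a (φ x) k)
      ≡⟨ cong (λ y → ∑[ x ∈ L ] (c x * φ x k) - y) (∑-shift L c φ a k) ⟩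
    oneMinusShift a (λ j → ∑[ x ∈ L ] (c x * φ x j)) k
      ∎
    where
    open ≡-Reasoning
    distribˡ-- : ∀ c u v → c * (u - v) ≡ c * u - c * v
    distribˡ-- = solve-∀

∑-concatMap : ∀ {A B : Set} (h : A → List B) L g → ∑ (concatMap h L) g ≡ ∑[ x ∈ L ] ∑ (h x) g
∑-concatMap h []      g = refl
∑-concatMap h (x ∷ L) g = trans (∑-++ (h x) _ g) (cong (λ y → ∑ (h x) g + y) (∑-concatMap h L g))

-- The second step of both proofs is by computation: (b ∷ X) ⊆? (true ∷ S) reduces to X ⊆? S,
-- and (true ∷ X) ⊆? (false ∷ S) to no.
module _ {n : ℕ} (S : Subset n) (g : Subset (suc n) → ℤ) where

  ∑-subsetsOf-inside : ∑ (subsetsOf (true ∷ S)) g ≡ ∑[ X ∈ subsetsOf S ] (g (true ∷ X) + g (false ∷ X))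
  ∑-subsetsOf-inside = begin
    ∑ (subsetsOf (true ∷ S)) g
      ≡⟨ ∑-filter (_⊆? (true ∷ S)) (allSubsets (suc n)) g ⟩
    ∑[ X ∈ allSubsets (suc n) ] (if does (X ⊆? (true ∷ S)) then g X else + 0)
      ≡⟨ ∑-concatMap (λ X → (true ∷ X) ∷ (false ∷ X) ∷ []) (allSubsets n) _ ⟩
    ∑[ X ∈ allSubsets n ] ((if does (X ⊆? S) then g (true ∷ X) else + 0)
                           + ((if does (X ⊆? S) then g (false ∷ X) else + 0) + + 0))
      ≡⟨ ∑-cong (allSubsets n) (λ X → if-+ (does (X ⊆? S)) (g (true ∷ X)) (g (false ∷ X))) ⟩
    ∑[ X ∈ allSubsets n ] (if does (X ⊆? S) then g (true ∷ X) + g (false ∷ X) else + 0)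
      ≡⟨ ∑-filter (_⊆? S) (allSubsets n) _ ⟨
    ∑[ X ∈ subsetsOf S ] (g (true ∷ X) + g (false ∷ X))
      ∎
    where
    open ≡-Reasoning
    if-+ : ∀ b u v → (if b then u else + 0) + ((if b then v else + 0) + + 0) ≡ (if b then u + v else + 0)
    if-+ true  u v = cong (λ y → u + y) (ℤ.+-identityʳ v)
    if-+ false u v = refl

  ∑-subsetsOf-outside : ∑ (subsetsOf (false ∷ S)) g ≡ ∑[ X ∈ subsetsOf S ] g (false ∷ X)
  ∑-subsetsOf-outside = begin
    ∑ (subsetsOf (false ∷ S)) g
      ≡⟨ ∑-filter (_⊆? (false ∷ S)) (allSubsets (suc n)) g ⟩
    ∑[ X ∈ allSubsets (suc n) ] (if does (X ⊆? (false ∷ S)) then g X else + 0)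
      ≡⟨ ∑-concatMap (λ X → (true ∷ X) ∷ (false ∷ X) ∷ []) (allSubsets n) _ ⟩
    ∑[ X ∈ allSubsets n ] (+ 0 + ((if does (X ⊆? S) then g (false ∷ X) else + 0) + + 0))
      ≡⟨ ∑-cong (allSubsets n) (λ X → trans (ℤ.+-identityˡ _) (ℤ.+-identityʳ _)) ⟩
    ∑[ X ∈ allSubsets n ] (if does (X ⊆? S) then g (false ∷ X) else + 0)
      ≡⟨ ∑-filter (_⊆? S) (allSubsets n) _ ⟨
    ∑[ X ∈ subsetsOf S ] g (false ∷ X)
      ∎
    where open ≡-Reasoning

fsum-∷ : ∀ {n} (f : Fin (suc n) → ℕ) b (X : Subset n) →
  fsum f (b ∷ X) ≡ (if b then f zero else 0) ℕ.+ fsum (f ∘ suc) X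
fsum-∷ {n} f b X = cong ((if b then f zero else 0) ℕ.+_) (begin
  foldr step 0 (tabulate suc)         ≡⟨ cong (foldr step 0) (Listₚ.map-tabulate (λ i → i) suc) ⟨
  foldr step 0 (map suc (allFin n))   ≡⟨ Listₚ.foldr-map step suc 0 (allFin n) ⟩
  fsum (f ∘ suc) X                    ∎)
  where
  open ≡-Reasoning
  step : Fin (suc n) → ℕ → ℕ
  step i acc = (if mem i (b ∷ X) then f i else 0) ℕ.+ acc

filter-map : ∀ {A B : Set} (g : A → B) {P : B → Set} (P? : Decidable P) (L : List A) →
  filter P? (map g L) ≡ map g (filter (P? ∘ g) L)
filter-map g P? []      = refl
filter-map g P? (x ∷ L) with does (P? (g x))
... | true  = cong (g x ∷_) (filter-map g P? L)
... | false = filter-map g P? L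

members-∷ : ∀ {n} b (X : Subset n) →
  filter (λ i → T? (mem i (b ∷ X))) (tabulate suc) ≡ map suc (members X)
members-∷ {n} b X =
  trans (cong (filter _) (sym (Listₚ.map-tabulate (λ i → i) suc))) (filter-map suc _ (allFin n))

-- prodSeq X f and termSeq S f X are the coefficients of Π_{s∈X} (1 − q^{f s}) and of
-- q^{f(S∖X)} Π_{s∈X} (1 − q^{f s}); expCoeffs S f w is 𝓔_S(w), by the recursion above.
prodSeq : ∀ {n} → Subset n → (Fin n → ℕ) → Seq
prodSeq []          f = coeff (constP (+ 1))
prodSeq (true ∷ X)  f = oneMinusShift (f zero) (prodSeq X (f ∘ suc))
prodSeq (false ∷ X) f = prodSeq X (f ∘ suc)

coeff-prodP : ∀ {n} (X : Subset n) f → coeff (prodP (map (oneMinus ∘ f) (members X))) ≗ prodSeq X f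
coeff-prodP []          f k = refl
coeff-prodP (true ∷ X)  f k = begin
  coeff (oneMinus (f zero) *P prodP (map (oneMinus ∘ f) (filter _ (tabulate suc)))) k
    ≡⟨ cong (λ L → coeff (oneMinus (f zero) *P prodP (map (oneMinus ∘ f) L)) k) (members-∷ true X) ⟩
  coeff (oneMinus (f zero) *P prodP (map (oneMinus ∘ f) (map suc (members X)))) k
    ≡⟨ cong (λ L → coeff (oneMinus (f zero) *P prodP L) k) (Listₚ.map-∘ (members X)) ⟨
  coeff (oneMinus (f zero) *P prodP (map (oneMinus ∘ f ∘ suc) (members X))) k
    ≡⟨ coeff-oneMinus-*P (f zero) _ k ⟩
  oneMinusShift (f zero) (coeff (prodP (map (oneMinus ∘ f ∘ suc) (members X)))) k
    ≡⟨ oneMinusShift-cong (f zero) (coeff-prodP X (f ∘ suc)) k ⟩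
  oneMinusShift (f zero) (prodSeq X (f ∘ suc)) k
    ∎
  where open ≡-Reasoning
coeff-prodP (false ∷ X) f k = begin
  coeff (prodP (map (oneMinus ∘ f) (filter _ (tabulate suc)))) k
    ≡⟨ cong (λ L → coeff (prodP (map (oneMinus ∘ f) L)) k) (members-∷ false X) ⟩
  coeff (prodP (map (oneMinus ∘ f) (map suc (members X)))) k
    ≡⟨ cong (λ L → coeff (prodP L) k) (Listₚ.map-∘ (members X)) ⟨
  coeff (prodP (map (oneMinus ∘ f ∘ suc) (members X))) k
    ≡⟨ coeff-prodP X (f ∘ suc) k ⟩
  prodSeq X (f ∘ suc) k
    ∎
  where open ≡-Reasoning

termSeq : ∀ {n} → Subset n → (Fin n → ℕ) → Subset n → Seq
termSeq S f X = shift (fsum f (diff S X)) (prodSeq X f)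

expCoeffs : ∀ {n} → Subset n → (Fin n → ℕ) → (Subset n → ℤ) → Seq
expCoeffs []          f w k = w [] * prodSeq [] f k
expCoeffs (true ∷ S)  f w k =
  oneMinusShift (f zero) (expCoeffs S (f ∘ suc) (w ∘ (true ∷_))) k
  + shift (f zero) (expCoeffs S (f ∘ suc) (w ∘ (false ∷_))) k
expCoeffs (false ∷ S) f w   = expCoeffs S (f ∘ suc) (w ∘ (false ∷_))

module _ {n} (S : Subset n) (f : Fin (suc n) → ℕ) (X : Subset n) where

  termSeq-inside-inside :
    termSeq (true ∷ S) f (true ∷ X) ≗ oneMinusShift (f zero) (termSeq S (f ∘ suc) X)
  termSeq-inside-inside k =
    trans (cong (λ d → shift d (prodSeq (true ∷ X) f) k) (fsum-∷ f false (diff S X)))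
          (shift-oneMinusShift (fsum (f ∘ suc) (diff S X)) (f zero) (prodSeq X (f ∘ suc)) k)

  termSeq-inside-outside : termSeq (true ∷ S) f (false ∷ X) ≗ shift (f zero) (termSeq S (f ∘ suc) X)
  termSeq-inside-outside k =
    trans (cong (λ d → shift d (prodSeq X (f ∘ suc)) k) (fsum-∷ f true (diff S X)))
          (shift-+ (f zero) (fsum (f ∘ suc) (diff S X)) (prodSeq X (f ∘ suc)) k)

  termSeq-outside-outside : termSeq (false ∷ S) f (false ∷ X) ≗ termSeq S (f ∘ suc) X
  termSeq-outside-outside k =
    cong (λ d → shift d (prodSeq X (f ∘ suc)) k) (fsum-∷ f false (diff S X))

∑-termSeq : ∀ {n} (S : Subset n) f w k → ∑[ X ∈ subsetsOf S ] (w X * termSeq S f X k) ≡ expCoeffs S f w k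
∑-termSeq []                f w k = ℤ.+-identityʳ _
∑-termSeq {suc n} (true ∷ S) f w k = begin
  ∑[ X ∈ subsetsOf (true ∷ S) ] (w X * termSeq (true ∷ S) f X k)
    ≡⟨ ∑-subsetsOf-inside S _ ⟩
  ∑[ X ∈ subsetsOf S ] (w (true ∷ X) * termSeq (true ∷ S) f (true ∷ X) k
                        + w (false ∷ X) * termSeq (true ∷ S) f (false ∷ X) k)
    ≡⟨ ∑-cong (subsetsOf S) (λ X →
         cong₂ _+_ (cong (w (true ∷ X) *_) (termSeq-inside-inside S f X k))
                   (cong (w (false ∷ X) *_) (termSeq-inside-outside S f X k))) ⟩
  ∑[ X ∈ subsetsOf S ] (w (true ∷ X) * oneMinusShift a (τ X) k + w (false ∷ X) * shift a (τ X) k)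
    ≡⟨ ∑-+ (subsetsOf S) _ _ ⟩
  ∑[ X ∈ subsetsOf S ] (w (true ∷ X) * oneMinusShift a (τ X) k)
  + ∑[ X ∈ subsetsOf S ] (w (false ∷ X) * shift a (τ X) k)
    ≡⟨ cong₂ _+_ (∑-oneMinusShift (subsetsOf S) (w ∘ (true ∷_)) τ a k)
                 (∑-shift (subsetsOf S) (w ∘ (false ∷_)) τ a k) ⟩
  oneMinusShift a (λ j → ∑[ X ∈ subsetsOf S ] (w (true ∷ X) * τ X j)) k
  + shift a (λ j → ∑[ X ∈ subsetsOf S ] (w (false ∷ X) * τ X j)) k
    ≡⟨ cong₂ _+_ (oneMinusShift-cong a (∑-termSeq S (f ∘ suc) (w ∘ (true ∷_))) k)
                 (shift-cong a (∑-termSeq S (f ∘ suc) (w ∘ (false ∷_))) k) ⟩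
  expCoeffs (true ∷ S) f w k
    ∎
  where
  open ≡-Reasoning
  a : ℕ
  a = f zero
  τ : Subset n → Seq
  τ = termSeq S (f ∘ suc)
∑-termSeq (false ∷ S)       f w k = begin
  ∑[ X ∈ subsetsOf (false ∷ S) ] (w X * termSeq (false ∷ S) f X k)
    ≡⟨ ∑-subsetsOf-outside S _ ⟩
  ∑[ X ∈ subsetsOf S ] (w (false ∷ X) * termSeq (false ∷ S) f (false ∷ X) k)
    ≡⟨ ∑-cong (subsetsOf S) (λ X → cong (w (false ∷ X) *_) (termSeq-outside-outside S f X k)) ⟩
  ∑[ X ∈ subsetsOf S ] (w (false ∷ X) * termSeq S (f ∘ suc) X k)
    ≡⟨ ∑-termSeq S (f ∘ suc) (w ∘ (false ∷_)) k ⟩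
  expCoeffs (false ∷ S) f w k
    ∎
  where open ≡-Reasoning

coeff-sumP : ∀ {A : Set} (t : A → Poly) L k → coeff (sumP (map t L)) k ≡ ∑[ x ∈ L ] coeff (t x) k
coeff-sumP t []      k = refl
coeff-sumP t (x ∷ L) k = trans (coeff-+P (t x) _ k) (cong (λ y → coeff (t x) k + y) (coeff-sumP t L k))

coeff-expObs : ∀ {n} (G : Graph n) S f → coeff (expObs G S f) ≗ expCoeffs S f (λ X → + ∣ Obs G X ∣)
coeff-expObs {n} G S f k = begin
  coeff (sumP (map term (subsetsOf S))) k
    ≡⟨ coeff-sumP term (subsetsOf S) k ⟩
  ∑[ X ∈ subsetsOf S ] coeff (term X) k
    ≡⟨ ∑-cong (subsetsOf S) coeff-term ⟩
  ∑[ X ∈ subsetsOf S ] (w X * termSeq S f X k)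
    ≡⟨ ∑-termSeq S f w k ⟩
  expCoeffs S f w k
    ∎
  where
  open ≡-Reasoning
  w : Subset n → ℤ
  w X = + ∣ Obs G X ∣
  term : Subset n → Poly
  term X = scaleP (w X) (monoP (fsum f (diff S X)) *P prodP (map (oneMinus ∘ f) (members X)))
  coeff-term : ∀ X → coeff (term X) k ≡ w X * termSeq S f X k
  coeff-term X = begin
    coeff (scaleP (w X) (monoP (fsum f (diff S X)) *P P)) k
      ≡⟨ coeff-scaleP (w X) (monoP (fsum f (diff S X)) *P P) k ⟩
    w X * coeff (monoP (fsum f (diff S X)) *P P) k
      ≡⟨ cong (w X *_) (coeff-monoP-*P (fsum f (diff S X)) P k) ⟩
    w X * shift (fsum f (diff S X)) (coeff P) k
      ≡⟨ cong (w X *_) (shift-cong (fsum f (diff S X)) (coeff-prodP X f) k) ⟩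
    w X * termSeq S f X k
      ∎
    where
    P : Poly
    P = prodP (map (oneMinus ∘ f) (members X))

fsum-⊥ : ∀ {n} (f : Fin n → ℕ) → fsum f ⊥ ≡ 0
fsum-⊥ {zero}  f = refl
fsum-⊥ {suc n} f = trans (fsum-∷ f false ⊥) (fsum-⊥ (f ∘ suc))

module _ {n} {S : Subset n} {f : Fin (suc n) → ℕ} where

  InR-∷ : ∀ {m b k} → InR m S (f ∘ suc) k → InR m (b ∷ S) f k
  InR-∷ (X , X⊆S , m≤∣X∣ , fX≡k) = false ∷ X , out⊆ X⊆S , m≤∣X∣ , trans (fsum-∷ f false X) fX≡k

  InR-inside : ∀ {m k j} → k ≡ f zero ℕ.+ j → InR m S (f ∘ suc) j → InR (suc m) (true ∷ S) f k
  InR-inside k≡ (X , X⊆S , m≤∣X∣ , fX≡j) =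
    true ∷ X , s⊆s X⊆S , s≤s m≤∣X∣ , trans (fsum-∷ f true X) (trans (cong (f zero ℕ.+_) fX≡j) (sym k≡))

InR-∅ : ∀ {n} (S : Subset n) f → InR 0 S f 0
InR-∅ S f = ⊥ , ⊥⊆ , z≤n , fsum-⊥ f

InR-≤ : ∀ {n m m' k} {S : Subset n} {f} → m' ≤ m → InR m S f k → InR m' S f k
InR-≤ m'≤m (X , X⊆S , m≤∣X∣ , fX≡k) = X , X⊆S , ℕ.≤-trans m'≤m m≤∣X∣ , fX≡k

Positive : ∀ {n} → Subset n → (Fin n → ℕ) → Set
Positive S f = ∀ s → s ∈ S → 1 ≤ f s

Positive-∷ : ∀ {n b} {S : Subset n} {f} → Positive (b ∷ S) f → Positive S (f ∘ suc)
Positive-∷ pos s s∈S = pos (suc s) (there s∈S)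

∣X∣≤fsum : ∀ {n} (X : Subset n) f → Positive X f → ∣ X ∣ ≤ fsum f X
∣X∣≤fsum []          f pos = z≤n
∣X∣≤fsum (true ∷ X)  f pos = subst (suc ∣ X ∣ ≤_) (sym (fsum-∷ f true X))
  (ℕ.+-mono-≤ (pos zero here) (∣X∣≤fsum X (f ∘ suc) (Positive-∷ pos)))
∣X∣≤fsum (false ∷ X) f pos = subst (∣ X ∣ ≤_) (sym (fsum-∷ f false X))
  (∣X∣≤fsum X (f ∘ suc) (Positive-∷ pos))

InR-positive : ∀ {n k} (S : Subset n) f → Positive S f → InR 1 S f k → 1 ≤ k
InR-positive S f pos (X , X⊆S , 1≤∣X∣ , fX≡k) =
  subst (1 ≤_) fX≡k (ℕ.≤-trans 1≤∣X∣ (∣X∣≤fsum X f (λ s → pos s ∘ X⊆S)))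

Monotone : ∀ {n} → (Subset n → ℤ) → Set
Monotone w = ∀ {X Y} → X ⊆ Y → w X ≤ℤ w Y

Monotone-∷ : ∀ {n} {w : Subset (suc n) → ℤ} b → Monotone w → Monotone (w ∘ (b ∷_))
Monotone-∷ b mono X⊆Y = mono (s⊆s X⊆Y)

expCoeffs-zero : ∀ {n} (S : Subset n) f w → Positive S f → expCoeffs S f w 0 ≡ w S
expCoeffs-zero []                f w pos = ℤ.*-identityʳ (w [])
expCoeffs-zero (false ∷ S)       f w pos = expCoeffs-zero S (f ∘ suc) (w ∘ (false ∷_)) (Positive-∷ pos)
expCoeffs-zero {suc n} (true ∷ S) f w pos = begin
  (E wT 0 - shift a (E wT) 0) + shift a (E wF) 0
    ≡⟨ cong₂ (λ x y → (E wT 0 - x) + y) (shift-at-0 (E wT) (pos zero here))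
                                         (shift-at-0 (E wF) (pos zero here)) ⟩
  (E wT 0 - + 0) + + 0
    ≡⟨ trans (ℤ.+-identityʳ _) (ℤ.+-identityʳ _) ⟩
  E wT 0
    ≡⟨ expCoeffs-zero S (f ∘ suc) wT (Positive-∷ pos) ⟩
  w (true ∷ S)
    ∎
  where
  open ≡-Reasoning
  a : ℕ
  a = f zero
  E : (Subset n → ℤ) → Seq
  E = expCoeffs S (f ∘ suc)
  wT wF : Subset n → ℤ
  wT = w ∘ (true ∷_)
  wF = w ∘ (false ∷_)

expCoeffs-vanishes : ∀ {n} (S : Subset n) f w k → 1 ≤ k → ¬ InR 1 S f k → expCoeffs S f w k ≡ + 0
expCoeffs-vanishes []                f w (suc k) _   _  = ℤ.*-zeroʳ (w [])
expCoeffs-vanishes (false ∷ S)       f w k       1≤k k∉ =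
  expCoeffs-vanishes S (f ∘ suc) (w ∘ (false ∷_)) k 1≤k (k∉ ∘ InR-∷)
expCoeffs-vanishes {suc n} (true ∷ S) f w k       1≤k k∉ = begin
  (E wT k - shift a (E wT) k) + shift a (E wF) k
    ≡⟨ cong₂ (λ x y → (x - y) + shift a (E wF) k)
             (expCoeffs-vanishes S (f ∘ suc) wT k 1≤k (k∉ ∘ InR-∷))
             (shift-vanishes a (E wT) k (shifted-vanishes wT)) ⟩
  + 0 + shift a (E wF) k
    ≡⟨ trans (ℤ.+-identityˡ _) (shift-vanishes a (E wF) k (shifted-vanishes wF)) ⟩
  + 0
    ∎
  where
  open ≡-Reasoning
  a : ℕ
  a = f zero
  E : (Subset n → ℤ) → Seq
  E = expCoeffs S (f ∘ suc)
  wT wF : Subset n → ℤ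
  wT = w ∘ (true ∷_)
  wF = w ∘ (false ∷_)
  shifted-vanishes : ∀ w' j → k ≡ a ℕ.+ j → E w' j ≡ + 0
  shifted-vanishes w' zero    k≡a+0 = ⊥-elim (k∉ (InR-inside k≡a+0 (InR-∅ S (f ∘ suc))))
  shifted-vanishes w' (suc j) k≡a+j =
    expCoeffs-vanishes S (f ∘ suc) w' (suc j) (s≤s z≤n) (k∉ ∘ InR-≤ (s≤s z≤n) ∘ InR-inside k≡a+j)

expCoeffs-nonpositive : ∀ {n} (S : Subset n) f w k → Positive S f → Monotone w →
  1 ≤ k → ¬ InR 2 S f k → expCoeffs S f w k ≤ℤ + 0
expCoeffs-nonpositive []                f w (suc k) _   _    _   _  = ℤ.≤-reflexive (ℤ.*-zeroʳ (w []))
expCoeffs-nonpositive (false ∷ S)       f w k       pos mono 1≤k k∉ =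
  expCoeffs-nonpositive S (f ∘ suc) (w ∘ (false ∷_)) k
    (Positive-∷ pos) (Monotone-∷ false mono) 1≤k (k∉ ∘ InR-∷)
expCoeffs-nonpositive {suc n} (true ∷ S) f w k       pos mono 1≤k k∉ =
  sub-add-≤
    (expCoeffs-nonpositive S (f ∘ suc) wT k (Positive-∷ pos) (Monotone-∷ true mono) 1≤k (k∉ ∘ InR-∷))
    (shift-mono-≤ a (E wF) (E wT) k shifted-≤)
  where
  a : ℕ
  a = f zero
  E : (Subset n → ℤ) → Seq
  E = expCoeffs S (f ∘ suc)
  wT wF : Subset n → ℤ
  wT = w ∘ (true ∷_)
  wF = w ∘ (false ∷_)
  shifted-≤ : ∀ j → k ≡ a ℕ.+ j → E wF j ≤ℤ E wT j
  shifted-≤ zero    _     = subst₂ _≤ℤ_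
    (sym (expCoeffs-zero S (f ∘ suc) wF (Positive-∷ pos)))
    (sym (expCoeffs-zero S (f ∘ suc) wT (Positive-∷ pos)))
    (mono (out⊆ id))
  shifted-≤ (suc j) k≡a+j = ℤ.≤-reflexive (trans (vanishes wF) (sym (vanishes wT)))
    where
    vanishes : ∀ w' → E w' (suc j) ≡ + 0
    vanishes w' = expCoeffs-vanishes S (f ∘ suc) w' (suc j) (s≤s z≤n) (k∉ ∘ InR-inside k≡a+j)
  sub-add-≤ : ∀ {x y z} → x ≤ℤ + 0 → z ≤ℤ y → (x - y) + z ≤ℤ + 0
  sub-add-≤ {x} {y} x≤0 z≤y =
    ℤ.≤-trans (ℤ.+-monoʳ-≤ (x - y) z≤y) (subst (_≤ℤ + 0) (sym (cancel x y)) x≤0)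
    where
    cancel : ∀ x y → (x - y) + y ≡ x
    cancel = solve-∀

filter-filter-⇒ : ∀ {A : Set} {P Q : A → Set} (P? : Decidable P) (Q? : Decidable Q) →
  (∀ {x} → P x → Q x) → ∀ xs → filter P? (filter Q? xs) ≡ filter P? xs
filter-filter-⇒ P? Q? P⇒Q []       = refl
filter-filter-⇒ P? Q? P⇒Q (x ∷ xs) with Q? x
... | no ¬Qx = trans (filter-filter-⇒ P? Q? P⇒Q xs) (sym (Listₚ.filter-reject P? (¬Qx ∘ P⇒Q)))
... | yes _ with does (P? x)
...   | true  = cong (x ∷_) (filter-filter-⇒ P? Q? P⇒Q xs)
...   | false = filter-filter-⇒ P? Q? P⇒Q xs

foldr-∨-mono : ∀ {A : Set} (g h : A → Bool) → (∀ x → g x ≡ true → h x ≡ true) → ∀ xs →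
  foldr (λ x b → g x ∨ b) false xs ≡ true → foldr (λ x b → h x ∨ b) false xs ≡ true
foldr-∨-mono g h g⇒h (x ∷ xs) any-g with g x in gx
... | true  rewrite g⇒h x gx = refl
... | false rewrite foldr-∨-mono g h g⇒h xs any-g = Bool.∨-zeroʳ (h x)

module _ {n : ℕ} where

  mem⇒∈ : ∀ {x : Fin n} {B} → mem x B ≡ true → x ∈ B
  mem⇒∈ {x} {B} = lookup⇒[]= x B

  ∉⇒mem : ∀ {x : Fin n} {B} → x ∉ B → mem x B ≡ false
  ∉⇒mem {x} {B} x∉B with mem x B in m
  ... | true  = contradiction (mem⇒∈ m) x∉B
  ... | false = refl

  mem⇒∉ : ∀ {x : Fin n} {B} → mem x B ≡ false → x ∉ B
  mem⇒∉ m x∈B = Bool.not-¬ ([]=⇒lookup x∈B) m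

  insert : Fin n → Subset n → Subset n
  insert y B = updateAt B y (λ _ → true)

  ⊆-insert : ∀ {y B} → B ⊆ insert y B
  ⊆-insert {y} {B} {x} x∈B with x ≟ y
  ... | yes refl = updateAt-updates x B x∈B
  ... | no x≢y   = updateAt-minimal x y B x≢y x∈B

  ∈-insert : ∀ {y B} → y ∈ insert y B
  ∈-insert {y} {B} = updateAt-updates y B (lookup⇒[]= y B refl)

  insert-⊆ : ∀ {y B C} → y ∈ C → B ⊆ C → insert y B ⊆ C
  insert-⊆ {y} {B} {C} y∈C B⊆C {x} x∈ with x ≟ y
  ... | yes refl = y∈C
  ... | no x≢y   = B⊆C (mem⇒∈ (trans (sym (lookup∘updateAt′ x y x≢y B)) ([]=⇒lookup x∈)))

  insert-⊂ : ∀ {y B} → y ∉ B → B ⊂ insert y B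
  insert-⊂ y∉B = ⊆-insert , _ , ∈-insert , y∉B

module _ {n : ℕ} (G : Graph n) where

  -- outside? B x is the test used by outsideNbrs G B x, so filter (outside? B x) (allFin n) is that list.
  private
    OutsideAt : Subset n → Fin n → Fin n → Set
    OutsideAt B x z = T (inClosedNbhd G x z ∧ not (mem z B))

    outside? : ∀ B x → Decidable (OutsideAt B x)
    outside? B x z = T? (inClosedNbhd G x z ∧ not (mem z B))

    outside⇒∉ : ∀ B x {z} → OutsideAt B x z → z ∉ B
    outside⇒∉ B x o = mem⇒∉ (Equivalence.to Bool.T-not-≡ (proj₂ (Equivalence.to Bool.T-∧ o)))

    outside-antitone : ∀ {B C} x → B ⊆ C → ∀ {z} → OutsideAt C x z → OutsideAt B x z
    outside-antitone {C = C} x B⊆C o with Equivalence.to Bool.T-∧ o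
    ... | adj , _ = Equivalence.from Bool.T-∧
                      (adj , Equivalence.from Bool.T-not-≡ (∉⇒mem (outside⇒∉ C x o ∘ B⊆C)))

    outside-intro : ∀ B C x {z} → OutsideAt B x z → z ∉ C → OutsideAt C x z
    outside-intro B C x o z∉C with Equivalence.to Bool.T-∧ o
    ... | adj , _ = Equivalence.from Bool.T-∧ (adj , Equivalence.from Bool.T-not-≡ (∉⇒mem z∉C))

  Forces : Subset n → Fin n → Fin n → Set
  Forces B x y = x ∈ B × outsideNbrs G B x ≡ y ∷ []

  Closed : Subset n → Set
  Closed B = ∀ {x y} → ¬ Forces B x y

  forced-∉ : ∀ {B x y} → outsideNbrs G B x ≡ y ∷ [] → y ∉ B
  forced-∉ {B} {x} {y} out =
    outside⇒∉ B x (proj₂ (∈-filter⁻ (outside? B x) {xs = allFin n}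
                                     (subst (y ∈ˡ_) (sym out) (here refl))))

  Closed-⊤ : Closed ⊤
  Closed-⊤ {x} (_ , out) = forced-∉ {⊤} {x} out ∈⊤

  forced-∈-Closed : ∀ {B C x y} → B ⊆ C → Closed C → Forces B x y → y ∈ C
  forced-∈-Closed {B} {C} {x} {y} B⊆C closed (x∈B , out) with y ∈? C
  ... | yes y∈C = y∈C
  ... | no  y∉C = ⊥-elim (closed (B⊆C x∈B , out-C))
    where
    open ≡-Reasoning
    y-outside : OutsideAt B x y
    y-outside = proj₂ (∈-filter⁻ (outside? B x) {xs = allFin n} (subst (y ∈ˡ_) (sym out) (here refl)))
    out-C : outsideNbrs G C x ≡ y ∷ []
    out-C = begin
      filter (outside? C x) (allFin n)
        ≡⟨ filter-filter-⇒ (outside? C x) (outside? B x) (outside-antitone x B⊆C) (allFin n) ⟨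
      filter (outside? C x) (filter (outside? B x) (allFin n))
        ≡⟨ cong (filter (outside? C x)) out ⟩
      filter (outside? C x) (y ∷ [])
        ≡⟨ Listₚ.filter-accept (outside? C x) (outside-intro B C x y-outside y∉C) ⟩
      y ∷ []
        ∎

  forcedFrom-just : ∀ {B y} xs → forcedFrom G B xs ≡ just y → ∃[ x ] Forces B x y
  forcedFrom-just {B} (x ∷ xs) found with mem x B in x∈B | outsideNbrs G B x in out
  ... | true  | _ ∷ []    = x , mem⇒∈ x∈B , trans out (cong (_∷ []) (just-injective found))
  ... | true  | []        = forcedFrom-just xs found
  ... | true  | _ ∷ _ ∷ _ = forcedFrom-just xs found
  ... | false | _         = forcedFrom-just xs found

  forcedFrom-head : ∀ {B x y} xs → Forces B x y → forcedFrom G B (x ∷ xs) ≡ just y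
  forcedFrom-head {B} {x} xs (x∈B , out) rewrite []=⇒lookup x∈B | out = refl

  forcedFrom-tail : ∀ {B} x xs → forcedFrom G B (x ∷ xs) ≡ nothing → forcedFrom G B xs ≡ nothing
  forcedFrom-tail {B} x xs none with mem x B | outsideNbrs G B x
  ... | true  | _ ∷ []    = case none of λ ()
  ... | true  | []        = none
  ... | true  | _ ∷ _ ∷ _ = none
  ... | false | _         = none

  forcedFrom-nothing : ∀ {B x y} xs → forcedFrom G B xs ≡ nothing → x ∈ˡ xs → ¬ Forces B x y
  forcedFrom-nothing (x ∷ xs) none (here refl) forces =
    case trans (sym (forcedFrom-head xs forces)) none of λ ()
  forcedFrom-nothing (x ∷ xs) none (there x∈xs)  = forcedFrom-nothing xs (forcedFrom-tail x xs none) x∈xs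

  forcedFrom-nothing⇒Closed : ∀ {B} → forcedFrom G B (allFin n) ≡ nothing → Closed B
  forcedFrom-nothing⇒Closed none {x} = forcedFrom-nothing (allFin n) none (∈-allFin x)

  propagate-⊇ : ∀ k B → B ⊆ propagate G k B
  propagate-⊇ zero    B = id
  propagate-⊇ (suc k) B with forcedFrom G B (allFin n)
  ... | nothing = id
  ... | just y  = propagate-⊇ k (insert y B) ∘ ⊆-insert

  propagate-least : ∀ k {B C} → Closed C → B ⊆ C → propagate G k B ⊆ C
  propagate-least zero    closed B⊆C = B⊆C
  propagate-least (suc k) {B} {C} closed B⊆C with forcedFrom G B (allFin n) in found
  ... | nothing = B⊆C
  ... | just y  = propagate-least k closed (insert-⊆ y∈C B⊆C)
    where
    y∈C : y ∈ C
    y∈C = forced-∈-Closed B⊆C closed (proj₂ (forcedFrom-just (allFin n) found))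

  propagate-Closed-or-grows : ∀ k B → Closed (propagate G k B) ⊎ k ℕ.+ ∣ B ∣ ≤ ∣ propagate G k B ∣
  propagate-Closed-or-grows zero    B = inj₂ ℕ.≤-refl
  propagate-Closed-or-grows (suc k) B with forcedFrom G B (allFin n) in found
  ... | nothing = inj₁ (forcedFrom-nothing⇒Closed found)
  ... | just y  with propagate-Closed-or-grows k (insert y B)
  ...   | inj₁ closed = inj₁ closed
  ...   | inj₂ grows  = inj₂ (begin
    suc k ℕ.+ ∣ B ∣           ≡⟨ ℕ.+-suc k ∣ B ∣ ⟨
    k ℕ.+ suc ∣ B ∣           ≤⟨ ℕ.+-monoʳ-≤ k (p⊂q⇒∣p∣<∣q∣ (insert-⊂ y∉B)) ⟩
    k ℕ.+ ∣ insert y B ∣      ≤⟨ grows ⟩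
    ∣ propagate G k (insert y B) ∣ ∎)
    where
    open ℕ.≤-Reasoning
    y∉B : y ∉ B
    y∉B with forcedFrom-just (allFin n) found
    ... | x , _ , out = forced-∉ {B} {x} out

  Obs-Closed : ∀ X → Closed (Obs G X)
  Obs-Closed X with propagate-Closed-or-grows n (closedNbhd G X)
  ... | inj₁ closed = closed
  ... | inj₂ grows  = subst Closed (sym (∣p∣≡n⇒p≡⊤ (ℕ.≤-antisym (∣p∣≤n (Obs G X))
                        (ℕ.≤-trans (ℕ.m≤m+n n _) grows)))) Closed-⊤

  closedNbhd-mono : ∀ {X Y} → X ⊆ Y → closedNbhd G X ⊆ closedNbhd G Y
  closedNbhd-mono {X} {Y} X⊆Y {y} y∈NX = mem⇒∈ (trans (lookup∘tabulate _ y)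
    (foldr-∨-mono (dominates X) (dominates Y) X⇒Y (allFin n)
      (trans (sym (lookup∘tabulate _ y)) ([]=⇒lookup y∈NX))))
    where
    dominates : Subset n → Fin n → Bool
    dominates Z x = mem x Z ∧ inClosedNbhd G x y
    X⇒Y : ∀ x → dominates X x ≡ true → dominates Y x ≡ true
    X⇒Y x adj with mem x X in x∈X
    ... | true rewrite []=⇒lookup (X⊆Y (mem⇒∈ x∈X)) = adj

  Obs-mono : ∀ {X Y} → X ⊆ Y → Obs G X ⊆ Obs G Y
  Obs-mono {X} {Y} X⊆Y =
    propagate-least n (Obs-Closed Y) (propagate-⊇ n (closedNbhd G Y) ∘ closedNbhd-mono X⊆Y)

proposition2p8 : ∀ {n} (G : Graph n) (S : Subset n) (f : Fin n → ℕ)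
    → (∀ s → s ∈ S → 1 ≤ f s)
    → ((k : ℕ) → 1 ≤ k → k ≤ fsum f S → ¬ InR 1 S f k → coeff (expObs G S f) k ≡ + 0)
      × ((k : ℕ) → InR 1 S f k → ¬ InR 2 S f k → coeff (expObs G S f) k ≤ℤ + 0)
      × (coeff (expObs G S f) 0 ≡ + ∣ Obs G S ∣ × + 0 ≤ℤ coeff (expObs G S f) 0)
proposition2p8 {n} G S f pos =
  (λ k 1≤k _ k∉R₁ → trans (coeff-expObs G S f k) (expCoeffs-vanishes S f w k 1≤k k∉R₁)) ,
  (λ k k∈R₁ k∉R₂ → subst (_≤ℤ + 0) (sym (coeff-expObs G S f k))
     (expCoeffs-nonpositive S f w k pos w-mono (InR-positive S f pos k∈R₁) k∉R₂)) ,
  coeff₀ ,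
  subst (+ 0 ≤ℤ_) (sym coeff₀) (+≤+ z≤n)
  where
  w : Subset n → ℤ
  w X = + ∣ Obs G X ∣
  w-mono : Monotone w
  w-mono X⊆Y = +≤+ (p⊆q⇒∣p∣≤∣q∣ (Obs-mono G X⊆Y))
  coeff₀ : coeff (expObs G S f) 0 ≡ + ∣ Obs G S ∣
  coeff₀ = trans (coeff-expObs G S f 0) (expCoeffs-zero S f w pos)
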